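{- Let $m\geqslant1$ be an integer. Define $h\colon\mathfrak S_{2m}\to\mathfrak S_{2m+2}$ by $h(u)=\eta(\alpha u^{ -1}\beta^{ -1})$, where, in one-line notation, $\alpha=(1\,3\,\ldots\,2m\!-\!1\;2\,4\,\ldots\,2m)\in\mathfrak S_{2m}$ and $\beta=(3\,5\,\ldots\,2m\!-\!1\;1\;2m\;2\,4\,\ldots\,2m\!-\!2)\in\mathfrak S_{2m}$, and $\eta\colon\mathfrak S_{2m}\to\mathfrak S_{2m+2}$ is given by $\eta(v)=(v(1)\!+\!1\;\,1\;\,v(2)\!+\!1\;\ldots\;v(2m\!-\!1)\!+\!1\;\,2m\!+\!2\;\,v(2m)\!+\!1)$. Then for every $u\in\mathfrak S_{2m}$, $$u\in[\mathrm{id},w_{2m}]\iff h(u)\in C_{2m+2}.$$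
   Context: $\mathfrak S_n$ is the group of permutations of $\{1,\ldots,n\}$; a permutation $\pi$ is written in one-line notation $(\pi(1)\,\pi(2)\,\ldots\,\pi(n))$, and products are compositions of functions: $(\alpha u^{ -1}\beta^{ -1})(x)=\alpha(u^{ -1}(\beta^{ -1}(x)))$. Thus $\eta(v)(1)=v(1)+1$, $\eta(v)(2)=1$, $\eta(v)(k)=v(k-1)+1$ for $3\leqslant k\leqslant 2m$, $\eta(v)(2m+1)=2m+2$, $\eta(v)(2m+2)=v(2m)+1$. The distance on $\mathfrak S_n$ is $D(u,v)=\sum_{i=1}^n|u(i)-v(i)|$, and $[\mathrm{id},u]=\{v\in\mathfrak S_n: D(\mathrm{id},v)+D(v,u)=D(\mathrm{id},u)\}$ (equivalently, $v\in[\mathrm{id},u]$ iff $\min(i,u(i))\leqslant v(i)\leqslant\max(i,u(i))$ for all $i$). $w_{2m}=(m\!+\!1\;m\!+\!2\;\ldots\;2m\;1\;2\;\ldots\;m)\in\mathfrak S_{2m}$. For $n\geqslant1$, $C_{2n}$ is the set of permutations $\pi\in\mathfrak S_{2n}$ such that $\pi(2i)<2i\leqslant\pi(2i-1)$ for all $i=1,\ldots,n$. -}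

module Defs where

open import Data.Nat using (ℕ; zero; suc; _+_; _*_; _∸_; _≤_; _<_; _≤ᵇ_; _≡ᵇ_; _⊔_; _⊓_)
open import Data.Bool using (Bool; true; false; if_then_else_; _∧_)
open import Data.Fin using (Fin; toℕ; fromℕ<)
open import Data.Fin.Permutation using (Permutation′; _⟨$⟩ʳ_; flip)
open import Data.Nat.Properties using (_<?_)
open import Relation.Nullary using (yes; no)
open import Data.Product using (_×_)

-- Convention: a permutation of {1,…,n} is a 'Permutation′ n' (a bijection on Fin n,
-- Fin n = {0,…,n-1}).  We read it as a 1-based map ℕ → ℕ via 'app'
-- (identity outside {1,…,n}, values there are irrelevant).
app : {n : ℕ} → Permutation′ n → ℕ → ℕ
app {n} π zero = zero
app {n} π (suc i) with i <? n
... | yes i<n = suc (toℕ (π ⟨$⟩ʳ fromℕ< i<n))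
... | no _ = suc i

-- inverse of a map f, bijective on {1,…,n}: the (unique) x ∈ {1,…,n} with f x = y
-- (found by search; returns y if none exists)
invOn : ℕ → (ℕ → ℕ) → ℕ → ℕ
invOn zero f y = y
invOn (suc k) f y = if f (suc k) ≡ᵇ y then suc k else invOn k f y

α : ℕ → ℕ → ℕ
α m i = if i ≤ᵇ m then 2 * i ∸ 1 else 2 * (i ∸ m)

β : ℕ → ℕ → ℕ
β m i = if suc i ≤ᵇ m then 2 * i + 1
        else if i ≡ᵇ m then 1
        else if i ≡ᵇ suc m then 2 * m
        else 2 * (i ∸ suc m)

η : ℕ → (ℕ → ℕ) → ℕ → ℕ
η m v k = if k ≡ᵇ 1 then v 1 + 1
          else if k ≡ᵇ 2 then 1
          else if k ≡ᵇ 2 * m + 1 then 2 * m + 2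
          else if k ≡ᵇ 2 * m + 2 then v (2 * m) + 1
          else v (k ∸ 1) + 1

-- h(u) = η(α u⁻¹ β⁻¹) (u⁻¹ = flip u; composition of functions, rightmost applied first)
h : (m : ℕ) → Permutation′ (2 * m) → ℕ → ℕ
h m u = η m (λ x → α m (app (flip u) (invOn (2 * m) (β m) x)))

-- w_{2m} = (m+1 m+2 … 2m 1 2 … m)
w : ℕ → ℕ → ℕ
w m i = if i ≤ᵇ m then m + i else i ∸ m

-- v ∈ [id, u] in S_n  iff  min(i,u(i)) ≤ v(i) ≤ max(i,u(i)) for all i ∈ {1,…,n}
InInterval : ℕ → (v u : ℕ → ℕ) → Set
InInterval n v u = ∀ i → 1 ≤ i → i ≤ n → (i ⊓ u i ≤ v i) × (v i ≤ i ⊔ u i)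

-- π ∈ C_{2n}  iff  π(2i) < 2i ≤ π(2i-1) for all i = 1,…,n
InC : ℕ → (ℕ → ℕ) → Set
InC n π = ∀ i → 1 ≤ i → i ≤ n → (π (2 * i) < 2 * i) × (2 * i ≤ π (2 * i ∸ 1))

-- Put v = α u⁻¹ β⁻¹, so that h(u) = η(v).  The first and last pairs of positions of η(v)
-- satisfy the defining inequalities of C automatically, and the remaining ones say
-- v(2j+1) ≤ 2j < v(2j) for 1 ≤ j < m.  Since β⁻¹ sends 2j+1 to j and 2j to m+1+j, and
-- α(k) ≤ 2j exactly when k ∈ [1, j] ∪ [m+1, m+j], this reads: u⁻¹(j) lies in that set and
-- u⁻¹(m+1+j) does not.  On the other side, u ∈ [id, w] says that every value y lies in the
-- window between k = u⁻¹(y) and w(k), i.e. [k, m+k] for k ≤ m and [k−m, k] for k > m.  For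
-- y = j and y = m+1+j this is exactly the condition above, while m and m+1 lie in every window.
module Submission where

open import Defs
open import Data.Bool using (true; false; if_then_else_)
open import Data.Unit using (tt)
open import Data.Fin using (Fin; toℕ; fromℕ<)
open import Data.Fin.Permutation using (Permutation′; _⟨$⟩ʳ_; _⟨$⟩ˡ_; flip; inverseˡ; inverseʳ)
open import Data.Fin.Properties using (toℕ<n; fromℕ<-toℕ; toℕ-fromℕ<)
open import Data.Nat
open import Data.Nat.Properties
open import Data.Product using (_×_; _,_; proj₁; proj₂)
open import Data.Sum using (_⊎_; inj₁; inj₂)
open import Function using (_∘_; id)
open import Function.Bundles using (_⇔_; mk⇔; Equivalence)
open Equivalence using (to; from)
open import Function.Properties.Equivalence using (⇔-setoid)
open import Level using (0ℓ)
import Relation.Binary.Reasoning.Setoid as SetoidReasoning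
open import Relation.Binary.PropositionalEquality
open import Relation.Binary.Definitions using (tri<; tri≈; tri>)
open import Relation.Nullary using (yes; no; contradiction)

private variable
  A : Set
  x y : A
  a b j k m n : ℕ

if-≤ᵇ-yes : m ≤ n → (if m ≤ᵇ n then x else y) ≡ x
if-≤ᵇ-yes {m} {n} m≤n with m ≤ᵇ n | ≤⇒≤ᵇ m≤n
... | true | _ = refl

if-≤ᵇ-no : m ≰ n → (if m ≤ᵇ n then x else y) ≡ y
if-≤ᵇ-no {m} {n} m≰n with m ≤ᵇ n | ≤ᵇ⇒≤ m n
... | false | _ = refl
... | true | sound = contradiction (sound tt) m≰n

if-≡ᵇ-yes : m ≡ n → (if m ≡ᵇ n then x else y) ≡ x
if-≡ᵇ-yes {m} {n} m≡n with m ≡ᵇ n | ≡⇒≡ᵇ m n m≡n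
... | true | _ = refl

if-≡ᵇ-no : m ≢ n → (if m ≡ᵇ n then x else y) ≡ y
if-≡ᵇ-no {m} {n} m≢n with m ≡ᵇ n | ≡ᵇ⇒≡ m n
... | false | _ = refl
... | true | sound = contradiction (sound tt) m≢n

app-suc : (π : Permutation′ n) (k<n : k < n) → app π (suc k) ≡ suc (toℕ (π ⟨$⟩ʳ fromℕ< k<n))
app-suc {n} {k} π k<n with k <? n
... | yes k<n′ rewrite <-irrelevant k<n k<n′ = refl
... | no k≮n = contradiction k<n k≮n

app-toℕ : (π : Permutation′ n) (i : Fin n) → app π (suc (toℕ i)) ≡ suc (toℕ (π ⟨$⟩ʳ i))
app-toℕ π i rewrite app-suc π (toℕ<n i) | fromℕ<-toℕ i (toℕ<n i) = refl

app-range : (π : Permutation′ n) → 1 ≤ k → k ≤ n → 1 ≤ app π k × app π k ≤ n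
app-range {k = suc k} π _ k≤n rewrite app-suc π k≤n = s≤s z≤n , toℕ<n _

app-flip-app : (π : Permutation′ n) → 1 ≤ k → k ≤ n → app (flip π) (app π k) ≡ k
app-flip-app {k = suc k} π _ k≤n
  rewrite app-suc π k≤n | app-toℕ (flip π) (π ⟨$⟩ʳ fromℕ< k≤n)
  = cong suc (trans (cong toℕ (inverseˡ π)) (toℕ-fromℕ< k≤n))

app-app-flip : (π : Permutation′ n) → 1 ≤ k → k ≤ n → app π (app (flip π) k) ≡ k
app-app-flip {k = suc k} π _ k≤n
  rewrite app-suc (flip π) k≤n | app-toℕ π (π ⟨$⟩ˡ fromℕ< k≤n)
  = cong suc (trans (cong toℕ (inverseʳ π)) (toℕ-fromℕ< k≤n))

graph-flip : (π : Permutation′ n) (P : ℕ → ℕ → Set) →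
  (∀ i → 1 ≤ i → i ≤ n → P i (app π i)) ⇔ (∀ j → 1 ≤ j → j ≤ n → P (app (flip π) j) j)
graph-flip π P = mk⇔
  (λ H j 1≤j j≤n → let (1≤i , i≤n) = app-range (flip π) 1≤j j≤n in
     subst (P _) (app-app-flip π 1≤j j≤n) (H _ 1≤i i≤n))
  (λ G i 1≤i i≤n → let (1≤j , j≤n) = app-range π 1≤i i≤n in
     subst (λ i′ → P i′ (app π i)) (app-flip-app π 1≤i i≤n) (G _ 1≤j j≤n))

-- invOn scans n, n ∸ 1, …, 1, so it returns the largest preimage.
invOn-last : (f : ℕ → ℕ) → 1 ≤ k → k ≤ n → f k ≡ y →
  (∀ k′ → k < k′ → k′ ≤ n → f k′ ≢ y) → invOn n f y ≡ k
invOn-last {n = zero} f (s≤s _) ()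
invOn-last {n = suc n} f 1≤k k≤n fk≡y later with m≤n⇒m<n∨m≡n k≤n
... | inj₂ refl = if-≡ᵇ-yes fk≡y
... | inj₁ (s≤s k≤n′) = trans (if-≡ᵇ-no (later (suc n) (s≤s k≤n′) ≤-refl))
  (invOn-last f 1≤k k≤n′ fk≡y (λ k′ k<k′ k′≤n → later k′ k<k′ (m≤n⇒m≤1+n k′≤n)))

invOn-range-or-default : ∀ n (f : ℕ → ℕ) y → (1 ≤ invOn n f y × invOn n f y ≤ n) ⊎ invOn n f y ≡ y
invOn-range-or-default zero f y = inj₂ refl
invOn-range-or-default (suc n) f y with f (suc n) ≡ᵇ y
... | true = inj₁ (s≤s z≤n , ≤-refl)
... | false with invOn-range-or-default n f y
...   | inj₁ (1≤i , i≤n) = inj₁ (1≤i , m≤n⇒m≤1+n i≤n)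
...   | inj₂ default = inj₂ default

invOn-range : (f : ℕ → ℕ) → 1 ≤ y → y ≤ n → 1 ≤ invOn n f y × invOn n f y ≤ n
invOn-range {y} {n} f 1≤y y≤n with invOn-range-or-default n f y
... | inj₁ inRange = inRange
... | inj₂ default rewrite default = 1≤y , y≤n

data Half (m : ℕ) : ℕ → Set where
  lower : k < m → Half m (suc k)
  upper : 1 ≤ a → a ≤ m → Half m (m + a)

half : ∀ m k → 1 ≤ k → k ≤ 2 * m → Half m k
half m (suc k) _ k≤2m with suc k ≤? m
... | yes k<m = lower k<m
... | no k≮m = subst (Half m) (m+[n∸m]≡n (<⇒≤ m<k)) (upper (m<n⇒0<n∸m m<k) (m≤n+o⇒m∸n≤o _ m k≤m+m))
  where
  m<k = ≰⇒> k≮m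
  k≤m+m = subst (suc k ≤_) (cong (m +_) (+-identityʳ m)) k≤2m

data Split (m : ℕ) : ℕ → Set where
  below : k < m → Split m k
  at : Split m m
  next : Split m (suc m)
  above : 1 ≤ a → Split m (suc m + a)

split : ∀ m k → Split m k
split m k with <-cmp k m
... | tri< k<m _ _ = below k<m
... | tri≈ _ refl _ = at
... | tri> _ _ m<k with m≤n⇒m<n∨m≡n m<k
...   | inj₂ refl = next
...   | inj₁ 1+m<k = subst (Split m) (m+[n∸m]≡n (<⇒≤ 1+m<k)) (above (m<n⇒0<n∸m 1+m<k))

α-lower : k < m → α m (suc k) ≡ suc (2 * k)
α-lower {k} k<m = trans (if-≤ᵇ-yes k<m) (cong (_∸ 1) (*-suc 2 k))

α-upper : ∀ m → 1 ≤ a → α m (m + a) ≡ 2 * a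
α-upper {a} m (s≤s z≤n) = trans (if-≤ᵇ-no (m+1+n≰m m)) (cong (2 *_) (m+n∸m≡n m a))

w-lower : k ≤ m → w m k ≡ m + k
w-lower = if-≤ᵇ-yes

w-upper : ∀ m → 1 ≤ a → w m (m + a) ≡ a
w-upper {a} m (s≤s z≤n) = trans (if-≤ᵇ-no (m+1+n≰m m)) (m+n∸m≡n m a)

β-below : k < m → β m k ≡ suc (2 * k)
β-below {k} k<m = trans (if-≤ᵇ-yes k<m) (+-comm (2 * k) 1)

β-at : ∀ m → β m m ≡ 1
β-at m = trans (if-≤ᵇ-no (n≮n m)) (if-≡ᵇ-yes {m = m} refl)

β-next : ∀ m → β m (suc m) ≡ 2 * m
β-next m = trans (if-≤ᵇ-no (n≮n m ∘ <-trans (n<1+n m))) (trans (if-≡ᵇ-no (1+n≢n {m})) (if-≡ᵇ-yes {m = m} refl))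

β-above : ∀ m → 1 ≤ a → β m (suc m + a) ≡ 2 * a
β-above {a} m (s≤s z≤n) = begin
  β m (suc m + a)  ≡⟨ if-≤ᵇ-no (n≮n m ∘ <-trans (s≤s (m≤m+n m _))) ⟩
  _                ≡⟨ if-≡ᵇ-no (m≢1+m+n m ∘ sym) ⟩
  _                ≡⟨ if-≡ᵇ-no (m+1+n≢m (suc m)) ⟩
  2 * (m + a ∸ m)  ≡⟨ cong (2 *_) (m+n∸m≡n m a) ⟩
  2 * a            ∎
  where open ≡-Reasoning

Between : ℕ → ℕ → ℕ → Set
Between a b x = a ⊓ b ≤ x × x ≤ a ⊔ b

between-≤ : a ≤ b → Between a b x ⇔ (a ≤ x × x ≤ b)
between-≤ {a} {b} a≤b rewrite m≤n⇒m⊓n≡m a≤b | m≤n⇒m⊔n≡n a≤b = mk⇔ id id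

between-≥ : b ≤ a → Between a b x ⇔ (b ≤ x × x ≤ a)
between-≥ {b} {a} b≤a rewrite m≥n⇒m⊓n≡n b≤a | m≥n⇒m⊔n≡m b≤a = mk⇔ id id

window-lower : k < m → Between (suc k) (w m (suc k)) x ⇔ (suc k ≤ x × x ≤ m + suc k)
window-lower {k} {m} k<m rewrite w-lower k<m = between-≤ (m≤n+m (suc k) m)

window-upper : 1 ≤ a → Between (m + a) (w m (m + a)) x ⇔ (a ≤ x × x ≤ m + a)
window-upper {a} {m} 1≤a rewrite w-upper m 1≤a = between-≥ (m≤n+m a m)

window-below⇔ : 1 ≤ k → k ≤ 2 * m → j < m → Between k (w m k) j ⇔ α m k ≤ 2 * j
window-below⇔ {k} {m} {j} 1≤k k≤2m j<m with half m k 1≤k k≤2m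
... | lower {k} k<m rewrite α-lower k<m = mk⇔
  (λ inside → *-monoʳ-< 2 (proj₁ (to (window-lower k<m) inside)))
  (λ 2k<2j → from (window-lower k<m) (*-cancelˡ-< 2 k j 2k<2j , ≤-trans (<⇒≤ j<m) (m≤m+n m _)))
... | upper {a} 1≤a a≤m rewrite α-upper m 1≤a = mk⇔
  (λ inside → *-monoʳ-≤ 2 (proj₁ (to (window-upper 1≤a) inside)))
  (λ 2a≤2j → from (window-upper 1≤a) (*-cancelˡ-≤ 2 2a≤2j , ≤-trans (<⇒≤ j<m) (m≤m+n m _)))

window-above⇔ : 1 ≤ k → k ≤ 2 * m → j < m → Between k (w m k) (suc m + j) ⇔ 2 * j < α m k
window-above⇔ {k} {m} {j} 1≤k k≤2m j<m with half m k 1≤k k≤2m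
... | lower {k} k<m rewrite α-lower k<m = mk⇔
  (λ inside → s≤s (*-monoʳ-≤ 2 (+-cancelˡ-≤ m j k
     (s≤s⁻¹ (≤-trans (proj₂ (to (window-lower k<m) inside)) (≤-reflexive (+-suc m k)))))))
  (λ 2j<1+2k → from (window-lower k<m)
     ( ≤-trans k<m (≤-trans (n≤1+n m) (m≤m+n (suc m) j))
     , ≤-trans (s≤s (+-monoʳ-≤ m (*-cancelˡ-≤ 2 (s≤s⁻¹ 2j<1+2k)))) (≤-reflexive (sym (+-suc m k)))))
... | upper {a} 1≤a a≤m rewrite α-upper m 1≤a = mk⇔
  (λ inside → *-monoʳ-< 2 (+-cancelˡ-≤ m (suc j) a
     (≤-trans (≤-reflexive (+-suc m j)) (proj₂ (to (window-upper 1≤a) inside)))))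
  (λ 2j<2a → from (window-upper 1≤a)
     ( ≤-trans a≤m (≤-trans (n≤1+n m) (m≤m+n (suc m) j))
     , ≤-trans (≤-reflexive (sym (+-suc m j))) (+-monoʳ-≤ m (*-cancelˡ-< 2 j a 2j<2a))))

window-middle : 1 ≤ k → k ≤ 2 * m → Between k (w m k) m × Between k (w m k) (suc m)
window-middle {k} {m} 1≤k k≤2m with half m k 1≤k k≤2m
... | lower {k} k<m =
    from (window-lower k<m) (k<m , m≤m+n m (suc k))
  , from (window-lower k<m) (m≤n⇒m≤1+n k<m , ≤-trans (s≤s (m≤m+n m k)) (≤-reflexive (sym (+-suc m k))))
... | upper {a} 1≤a a≤m =
    from (window-upper 1≤a) (a≤m , m≤m+n m a)
  , from (window-upper 1≤a) (m≤n⇒m≤1+n a≤m , ≤-trans (≤-reflexive (+-comm 1 m)) (+-monoʳ-≤ m 1≤a))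

1+m+j≤2*m⇔j<m : suc m + j ≤ 2 * m ⇔ j < m
1+m+j≤2*m⇔j<m {m} {j} = mk⇔
  (λ le → +-cancelˡ-≤ m (suc j) m (≤-trans (≤-reflexive (+-suc m j)) (subst (suc m + j ≤_) m+m≡2m le)))
  (λ j<m → subst (suc m + j ≤_) (sym m+m≡2m) (+-monoʳ-< m j<m))
  where
  m+m≡2m : 2 * m ≡ m + m
  m+m≡2m = cong (m +_) (+-identityʳ m)

Every : ℕ → (ℕ → Set) → Set
Every m P = ∀ j → 1 ≤ j → j < m → P j

Every-cong : {P Q : ℕ → Set} → (∀ j → 1 ≤ j → j < m → P j ⇔ Q j) → Every m P ⇔ Every m Q
Every-cong P⇔Q = mk⇔
  (λ all j 1≤j j<m → to (P⇔Q j 1≤j j<m) (all j 1≤j j<m))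
  (λ all j 1≤j j<m → from (P⇔Q j 1≤j j<m) (all j 1≤j j<m))

windows⇔α-straddles : (U : ℕ → ℕ) → (∀ y → 1 ≤ y → y ≤ 2 * m → 1 ≤ U y × U y ≤ 2 * m) →
  (∀ y → 1 ≤ y → y ≤ 2 * m → Between (U y) (w m (U y)) y) ⇔
  Every m (λ j → α m (U j) ≤ 2 * j × 2 * j < α m (U (suc m + j)))
windows⇔α-straddles {m} U U-range = mk⇔
  (λ inside j 1≤j j<m →
    let (1≤U , U≤2m) = U-range j 1≤j (j≤2m j<m)
        (1≤U′ , U′≤2m) = U-range (suc m + j) (s≤s z≤n) (from 1+m+j≤2*m⇔j<m j<m) in
      to (window-below⇔ 1≤U U≤2m j<m) (inside j 1≤j (j≤2m j<m))
    , to (window-above⇔ 1≤U′ U′≤2m j<m) (inside (suc m + j) (s≤s z≤n) (from 1+m+j≤2*m⇔j<m j<m)))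
  (λ straddles y 1≤y y≤2m → let (1≤U , U≤2m) = U-range y 1≤y y≤2m in window∋ straddles 1≤y y≤2m 1≤U U≤2m)
  where
  j≤2m : j < m → j ≤ 2 * m
  j≤2m j<m = ≤-trans (<⇒≤ j<m) (m≤m+n m _)
  window∋ : Every m (λ j → α m (U j) ≤ 2 * j × 2 * j < α m (U (suc m + j))) → 1 ≤ y → y ≤ 2 * m →
    1 ≤ U y → U y ≤ 2 * m → Between (U y) (w m (U y)) y
  window∋ {y} straddles 1≤y y≤2m 1≤U U≤2m with split m y
  ... | below y<m = from (window-below⇔ 1≤U U≤2m y<m) (proj₁ (straddles y 1≤y y<m))
  ... | at = proj₁ (window-middle 1≤U U≤2m)
  ... | next = proj₂ (window-middle 1≤U U≤2m)
  ... | above {j} 1≤j = from (window-above⇔ 1≤U U≤2m j<m) (proj₂ (straddles j 1≤j j<m))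
    where j<m = to 1+m+j≤2*m⇔j<m y≤2m

β⁻¹-odd : 1 ≤ j → j < m → invOn (2 * m) (β m) (suc (2 * j)) ≡ j
β⁻¹-odd {suc j} {m} (s≤s z≤n) j<m = invOn-last (β m) (s≤s z≤n) (≤-trans (<⇒≤ j<m) (m≤m+n m _)) (β-below j<m) later
  where
  later : ∀ k → suc j < k → k ≤ 2 * m → β m k ≢ suc (2 * suc j)
  later k j<k _ βk≡ with split m k
  ... | below k<m = <⇒≢ j<k (*-cancelˡ-≡ (suc j) k 2 (suc-injective (trans (sym βk≡) (β-below k<m))))
  ... | at = 1+n≢0 (sym (suc-injective (trans (sym (β-at m)) βk≡)))
  ... | next = even≢odd m (suc j) (trans (sym (β-next m)) βk≡)
  ... | above {a} 1≤a = even≢odd a (suc j) (trans (sym (β-above m 1≤a)) βk≡)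

β⁻¹-even : 1 ≤ j → j < m → invOn (2 * m) (β m) (2 * j) ≡ suc m + j
β⁻¹-even {j} {m} 1≤j j<m = invOn-last (β m) (s≤s z≤n) (from 1+m+j≤2*m⇔j<m j<m) (β-above m 1≤j) later
  where
  later : ∀ k → suc m + j < k → k ≤ 2 * m → β m k ≢ 2 * j
  later k j<k _ βk≡ with split m k
  ... | below k<m = n≮n k (<-trans k<m (<-trans (n<1+n m) 1+m<k))
    where 1+m<k = ≤-<-trans (m≤m+n (suc m) j) j<k
  ... | at = n≮n m (<-trans (n<1+n m) (≤-<-trans (m≤m+n (suc m) j) j<k))
  ... | next = n≮n (suc m) (≤-<-trans (m≤m+n (suc m) j) j<k)
  ... | above {a} 1≤a = <⇒≢ j<k (cong (suc m +_) (sym (*-cancelˡ-≡ a j 2 (trans (sym (β-above m 1≤a)) βk≡))))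

α-range : 1 ≤ k → k ≤ 2 * m → 1 ≤ α m k × α m k ≤ 2 * m
α-range {k} {m} 1≤k k≤2m with half m k 1≤k k≤2m
... | lower {k} k<m rewrite α-lower k<m = s≤s z≤n , ≤-trans (n≤1+n _) (subst (_≤ 2 * m) (*-suc 2 k) (*-monoʳ-≤ 2 k<m))
... | upper {a} 1≤a a≤m rewrite α-upper m 1≤a = ≤-trans 1≤a (m≤m+n a _) , *-monoʳ-≤ 2 a≤m

j<m⇒2+2j≤2m : j < m → suc (suc (2 * j)) ≤ 2 * m
j<m⇒2+2j≤2m {j} {m} j<m = subst (_≤ 2 * m) (*-suc 2 j) (*-monoʳ-≤ 2 j<m)

module _ {m : ℕ} {v : ℕ → ℕ} where

  η-middle : 3 ≤ k → k ≤ 2 * m → η m v k ≡ v (k ∸ 1) + 1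
  η-middle 3≤k k≤2m =
    trans (if-≡ᵇ-no (>⇒≢ (<-trans (n<1+n 1) 3≤k)))
    (trans (if-≡ᵇ-no (>⇒≢ 3≤k))
    (trans (if-≡ᵇ-no (<⇒≢ (≤-trans (s≤s k≤2m) (≤-reflexive (+-comm 1 (2 * m))))))
    (if-≡ᵇ-no (<⇒≢ (≤-trans (s≤s k≤2m) (≤-trans (n≤1+n _) (≤-reflexive (+-comm 2 (2 * m)))))))))

  η-odd-top : 1 ≤ m → η m v (suc (2 * m)) ≡ 2 * m + 2
  η-odd-top 1≤m =
    trans (if-≡ᵇ-no (>⇒≢ 0<2m))
    (trans (if-≡ᵇ-no (even≢odd m 0))
    (if-≡ᵇ-yes (+-comm 1 (2 * m))))
    where 0<2m = ≤-trans 1≤m (m≤m+n m _)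

  η-even-top : 1 ≤ m → η m v (suc (suc (2 * m))) ≡ v (2 * m) + 1
  η-even-top 1≤m =
    trans (if-≡ᵇ-no (>⇒≢ (≤-trans 1≤m (m≤m+n m _))))
    (trans (if-≡ᵇ-no (>⇒≢ (s≤s (≤-reflexive (+-comm (2 * m) 1)))))
    (if-≡ᵇ-yes (+-comm 2 (2 * m))))

  η-bottom : 1 ≤ v 1 → η m v (2 * 1) < 2 * 1 × 2 * 1 ≤ η m v (2 * 1 ∸ 1)
  η-bottom 1≤v1 = s≤s (s≤s z≤n) , subst (2 ≤_) (+-comm 1 (v 1)) (s≤s 1≤v1)

  η-inner⇔ : 1 ≤ j → j < m →
    (η m v (2 * suc j) < 2 * suc j × 2 * suc j ≤ η m v (2 * suc j ∸ 1)) ⇔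
    (v (suc (2 * j)) ≤ 2 * j × 2 * j < v (2 * j))
  η-inner⇔ {j} 1≤j j<m = mk⇔
    (λ (lo , hi) → s≤s⁻¹ (s≤s⁻¹ (subst₂ _<_ at-even 2+2j lo)) , s≤s⁻¹ (subst₂ _≤_ 2+2j at-odd hi))
    (λ (lo , hi) → subst₂ _<_ (sym at-even) (sym 2+2j) (s≤s (s≤s lo)) , subst₂ _≤_ (sym 2+2j) (sym at-odd) (s≤s hi))
    where
    2+2j : 2 * suc j ≡ suc (suc (2 * j))
    2+2j = *-suc 2 j
    at-even : η m v (2 * suc j) ≡ suc (v (suc (2 * j)))
    at-even = trans (cong (η m v) 2+2j)
      (trans (η-middle (s≤s (s≤s (≤-trans 1≤j (m≤m+n j _)))) (j<m⇒2+2j≤2m j<m)) (+-comm _ 1))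
    at-odd : η m v (2 * suc j ∸ 1) ≡ suc (v (2 * j))
    at-odd = trans (cong (λ k → η m v (k ∸ 1)) 2+2j)
      (trans (η-middle (s≤s (*-monoʳ-≤ 2 1≤j)) (≤-trans (n≤1+n _) (j<m⇒2+2j≤2m j<m))) (+-comm _ 1))

  η-top : 1 ≤ m → v (2 * m) ≤ 2 * m →
    η m v (2 * suc m) < 2 * suc m × 2 * suc m ≤ η m v (2 * suc m ∸ 1)
  η-top 1≤m v≤2m =
      subst₂ _<_ (sym at-even) (sym 2+2m) (s≤s (s≤s v≤2m))
    , subst₂ _≤_ (sym 2+2m) (sym at-odd) (≤-reflexive (+-comm 2 (2 * m)))
    where
    2+2m : 2 * suc m ≡ suc (suc (2 * m))
    2+2m = *-suc 2 m
    at-even : η m v (2 * suc m) ≡ suc (v (2 * m))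
    at-even = trans (cong (η m v) 2+2m) (trans (η-even-top 1≤m) (+-comm _ 1))
    at-odd : η m v (2 * suc m ∸ 1) ≡ 2 * m + 2
    at-odd = trans (cong (λ k → η m v (k ∸ 1)) 2+2m) (η-odd-top 1≤m)

  InC-η⇔ : 1 ≤ m → 1 ≤ v 1 → v (2 * m) ≤ 2 * m →
    InC (m + 1) (η m v) ⇔ Every m (λ j → v (suc (2 * j)) ≤ 2 * j × 2 * j < v (2 * j))
  InC-η⇔ 1≤m 1≤v1 v≤2m = mk⇔
    (λ inC j 1≤j j<m → to (η-inner⇔ 1≤j j<m) (inC (suc j) (s≤s z≤n) (≤-trans j<m (m≤m+n m 1))))
    (λ every i 1≤i i≤m+1 → pair every i 1≤i (subst (i ≤_) (+-comm m 1) i≤m+1))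
    where
    pair : Every m (λ j → v (suc (2 * j)) ≤ 2 * j × 2 * j < v (2 * j)) →
      ∀ i → 1 ≤ i → i ≤ suc m → η m v (2 * i) < 2 * i × 2 * i ≤ η m v (2 * i ∸ 1)
    pair every (suc zero) _ _ = η-bottom 1≤v1
    pair every (suc (suc j)) _ i≤1+m with m≤n⇒m<n∨m≡n (s≤s⁻¹ i≤1+m)
    ... | inj₁ j<m = from (η-inner⇔ (s≤s z≤n) j<m) (every (suc j) (s≤s z≤n) j<m)
    ... | inj₂ refl = η-top 1≤m v≤2m

mainTheorem3 : (m : ℕ) → 1 ≤ m → (u : Permutation′ (2 * m)) →
    InInterval (2 * m) (app u) (w m) ⇔ InC (m + 1) (h m u)
mainTheorem3 m 1≤m u = begin
  InInterval (2 * m) (app u) (w m)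
    ≈⟨ graph-flip u (λ k y → Between k (w m k) y) ⟩
  (∀ y → 1 ≤ y → y ≤ 2 * m → Between (u⁻¹ y) (w m (u⁻¹ y)) y)
    ≈⟨ windows⇔α-straddles u⁻¹ (λ _ → app-range (flip u)) ⟩
  Every m (λ j → α m (u⁻¹ j) ≤ 2 * j × 2 * j < α m (u⁻¹ (suc m + j)))
    ≈⟨ Every-cong relabel ⟩
  Every m (λ j → v (suc (2 * j)) ≤ 2 * j × 2 * j < v (2 * j))
    ≈⟨ InC-η⇔ {v = v} 1≤m (proj₁ (v-range ≤-refl 1≤2m)) (proj₂ (v-range 1≤2m ≤-refl)) ⟨
  InC (m + 1) (h m u) ∎
  where
  open SetoidReasoning (⇔-setoid 0ℓ)
  u⁻¹ : ℕ → ℕ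
  u⁻¹ = app (flip u)
  v : ℕ → ℕ
  v y = α m (u⁻¹ (invOn (2 * m) (β m) y))
  1≤2m : 1 ≤ 2 * m
  1≤2m = ≤-trans 1≤m (m≤m+n m _)
  v-range : 1 ≤ y → y ≤ 2 * m → 1 ≤ v y × v y ≤ 2 * m
  v-range 1≤y y≤2m =
    let (1≤z , z≤2m) = invOn-range (β m) 1≤y y≤2m in
    let (1≤x , x≤2m) = app-range (flip u) 1≤z z≤2m in
    α-range 1≤x x≤2m
  relabel : ∀ j → 1 ≤ j → j < m →
    (α m (u⁻¹ j) ≤ 2 * j × 2 * j < α m (u⁻¹ (suc m + j))) ⇔ (v (suc (2 * j)) ≤ 2 * j × 2 * j < v (2 * j))
  relabel j 1≤j j<m rewrite β⁻¹-odd 1≤j j<m | β⁻¹-even 1≤j j<m = mk⇔ id id
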